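{- Let $k \ge 1$ and $n$ be positive integers, let $H$ be a subgraph of $Q_n$ isomorphic to $(P_3)^k$, and let $S$ be a subcube of $Q_n$ of co-dimension $1$, i.e. $S=\{x\in\{0,1\}^n : x_i = \varepsilon\}$ for some coordinate $i\in[n]$ and some $\varepsilon\in\{0,1\}$. Then the subgraph of $H$ induced by $V(H)\cap S$ is isomorphic to one of the following: the empty graph (no vertices), $(P_3)^{k-1}$, $P_2\times(P_3)^{k-1}$, or $(P_3)^k$.
   Context: $Q_n$ is the $n$-dimensional hypercube on $\{0,1\}^n$ (vertices adjacent iff they differ in exactly one coordinate); $P_m$ is the path on $m$ vertices. For graphs $G_1,G_2$ the Cartesian product $G_1\times G_2$ has vertex set $V(G_1)\times V(G_2)$, with $(u_1,u_2)\sim(v_1,v_2)$ iff either $u_1=v_1$ and $u_2v_2\in E(G_2)$, or $u_2=v_2$ and $u_1v_1\in E(G_1)$; $G^k$ is the product of $k$ copies of $G$, and $G^0$ is the single-vertex graph. -}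

module Defs where

open import Data.Nat using (ℕ; zero; suc; _+_)
open import Data.Fin using (Fin; toℕ)
open import Data.Bool using (Bool; T; true; false)
open import Data.Bool.Properties using () renaming (_≟_ to _≟ᵇ_)
open import Data.Vec using (Vec; lookup)
open import Data.Product using (Σ; _×_; _,_; proj₁)
open import Data.Sum using (_⊎_)
open import Data.Empty using (⊥)
open import Data.Unit using (⊤)
open import Relation.Nullary using (¬_; does)
open import Relation.Binary.PropositionalEquality using (_≡_; _≢_)

record Graph : Set₁ where
  field
    V : Set
    E : V → V → Set
open Graph public

record _≅_ (G H : Graph) : Set where
  field
    to      : V G → V H
    from    : V H → V G
    from∘to : ∀ x → from (to x) ≡ x
    to∘from : ∀ y → to (from y) ≡ y
    to-adj  : ∀ x y → E G x y → E H (to x) (to y)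
    from-adj : ∀ x y → E H (to x) (to y) → E G x y
open _≅_ public

Q : ℕ → Graph
V (Q n) = Vec Bool n
E (Q n) x y = Σ (Fin n) λ i →
  (lookup x i ≢ lookup y i) × (∀ j → j ≢ i → lookup x j ≡ lookup y j)

P : ℕ → Graph
V (P m) = Fin m
E (P m) i j = (suc (toℕ i) ≡ toℕ j) ⊎ (suc (toℕ j) ≡ toℕ i)

_□_ : Graph → Graph → Graph
V (G □ H) = V G × V H
E (G □ H) (u₁ , u₂) (v₁ , v₂) =
  ((u₁ ≡ v₁) × E H u₂ v₂) ⊎ ((u₂ ≡ v₂) × E G u₁ v₁)

K₁ : Graph
V K₁ = ⊤
E K₁ _ _ = ⊥

_^_ : Graph → ℕ → Graph
G ^ zero  = K₁
G ^ suc k = G □ (G ^ k)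

Empty : Graph
V Empty = ⊥
E Empty _ _ = ⊥

record Subgraph (G : Graph) : Set₁ where
  field
    vs  : V G → Bool
    es  : V G → V G → Bool
    es-sym : ∀ x y → es x y ≡ es y x
    es-E   : ∀ x y → T (es x y) → E G x y
    es-vs  : ∀ x y → T (es x y) → T (vs x) × T (vs y)
open Subgraph public

asGraph : {G : Graph} → Subgraph G → Graph
V (asGraph {G} H) = Σ (V G) λ x → T (vs H x)
E (asGraph H) (x , _) (y , _) = T (es H x y)

induced : (G : Graph) → (V G → Bool) → Graph
V (induced G p) = Σ (V G) λ x → T (p x)
E (induced G p) (x , _) (y , _) = E G x y

inSubcube : {n : ℕ} → Fin n → Bool → Vec Bool n → Bool
inSubcube i ε x = does (lookup x i ≟ᵇ ε)

module Submission where

-- Write H ≅ (P₃)ᵏ as an embedding φ of the grid (P₃)ᵏ into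
-- Q n, i.e. an injective, adjacency-preserving map, and classify the set of
-- grid vertices whose image has coordinate i equal to ε.  Viewing the grid
-- as P₃ □ (P₃)ᵏ⁻¹, i.e. three rows 0,1,2 over (P₃)ᵏ⁻¹, two facts about 4-cycles
-- of the hypercube do the work: opposite sides of a non-degenerate 4-cycle are
-- parallel, and two consecutive edges in the same direction backtrack.  Since
-- (P₃)ᵏ⁻¹ is connected, all rungs between rows 0 and 1 are parallel, say in
-- direction d₀, and all rungs between rows 1 and 2 in direction d₁ ≠ d₀.  If
-- i ∉ {d₀, d₁}, coordinate i does not depend on the row and we recurse into
-- row 0; if i = d₀ (resp. d₁), coordinate i is constant on each row and only
-- flips between rows 0,1 (resp. 1,2), so the subcube cuts off one or two whole
-- rows.

open import Defs
open import Data.Nat using (ℕ; zero; suc; _≤_; _∸_)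
open import Data.Fin using (Fin; zero; suc)
open import Data.Fin.Properties using () renaming (_≟_ to _≟ᶠ_)
open import Data.Bool using (Bool; true; false; T; not)
open import Data.Bool.Properties using (T-irrelevant; not-¬; ¬-not; not-involutive)
  renaming (_≟_ to _≟ᵇ_)
open import Data.Vec using (Vec; lookup)
open import Data.Vec.Properties using (tabulate∘lookup; tabulate-cong)
open import Data.Product using (Σ; _,_; proj₁; proj₂)
open import Data.Sum using (_⊎_; inj₁; inj₂)
open import Data.Empty using (⊥-elim)
open import Data.Unit using (tt)
open import Relation.Nullary using (¬_; Dec; yes; no; does)
open import Relation.Binary.PropositionalEquality
open ≡-Reasoning

vec-ext : {A : Set} {n : ℕ} {x y : Vec A n} → (∀ j → lookup x j ≡ lookup y j) → x ≡ y
vec-ext {x = x} {y} same =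
  trans (sym (tabulate∘lookup x)) (trans (tabulate-cong same) (tabulate∘lookup y))

Σ-T-≡ : {A : Set} {p : A → Bool} {x y : A} {px : T (p x)} {py : T (p y)} →
        x ≡ y → _≡_ {A = Σ A (λ z → T (p z))} (x , px) (y , py)
Σ-T-≡ refl = cong (_ ,_) (T-irrelevant _ _)

-- Adjacency in Q n (as in Defs), packaged as a record so that an edge
-- determines its endpoints; dir is the unique coordinate in which they differ.
record Edge {n : ℕ} (x y : Vec Bool n) : Set where
  constructor edge
  field
    dir    : Fin n
    differ : lookup x dir ≢ lookup y dir
    agree  : ∀ j → j ≢ dir → lookup x j ≡ lookup y j
open Edge

Q-edge : {n : ℕ} {x y : Vec Bool n} → E (Q n) x y → Edge x y
Q-edge (d , differ , agree) = edge d differ agree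

module _ {n : ℕ} where

  edge-sym : {x y : Vec Bool n} → Edge x y → Edge y x
  edge-sym (edge d differ agree) = edge d (λ eq → differ (sym eq)) (λ j j≢d → sym (agree j j≢d))

  coord-off : {x y : Vec Bool n} (e : Edge x y) {j : Fin n} →
              j ≢ dir e → lookup y j ≡ lookup x j
  coord-off e j≢d = sym (agree e _ j≢d)

  coord-on : {x y : Vec Bool n} (e : Edge x y) {j : Fin n} →
             j ≡ dir e → lookup y j ≡ not (lookup x j)
  coord-on e refl = ¬-not (λ eq → differ e (sym eq))

  flip⇒dir : {x y : Vec Bool n} (e : Edge x y) {j : Fin n} →
             lookup y j ≡ not (lookup x j) → j ≡ dir e
  flip⇒dir e {j} flipped with j ≟ᶠ dir e
  ... | yes j≡d = j≡d
  ... | no j≢d = ⊥-elim (not-¬ refl (trans (sym (coord-off e j≢d)) flipped))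

  backtrack : {x y z : Vec Bool n} (e : Edge x y) (e' : Edge y z) → dir e ≡ dir e' → x ≡ z
  backtrack {x} {y} {z} e e' same = vec-ext coord
    where
    coord : ∀ j → lookup x j ≡ lookup z j
    coord j with j ≟ᶠ dir e
    ... | yes j≡d = sym (begin
      lookup z j             ≡⟨ coord-on e' (trans j≡d same) ⟩
      not (lookup y j)       ≡⟨ cong not (coord-on e j≡d) ⟩
      not (not (lookup x j)) ≡⟨ not-involutive _ ⟩
      lookup x j             ∎)
    ... | no j≢d = sym (trans (coord-off e' (λ eq → j≢d (trans eq (sym same)))) (coord-off e j≢d))

  -- Opposite sides of a 4-cycle x₁x₂x₃x₄ with distinct diagonals are parallel:
  -- otherwise x₁ and x₄ would differ in two directions.
  parallel-sides : {x₁ x₂ x₃ x₄ : Vec Bool n}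
    (e₁₂ : Edge x₁ x₂) (e₂₃ : Edge x₂ x₃) (e₄₃ : Edge x₄ x₃) (e₁₄ : Edge x₁ x₄) →
    x₁ ≢ x₃ → x₂ ≢ x₄ → dir e₁₂ ≡ dir e₄₃
  parallel-sides {x₁} {x₂} {x₃} {x₄} e₁₂ e₂₃ e₄₃ e₁₄ x₁≢x₃ x₂≢x₄
    with dir e₄₃ ≟ᶠ dir e₁₂
  ... | yes d₃≡d₁ = sym d₃≡d₁
  ... | no d₃≢d₁ =
    ⊥-elim (d₂≢d₁ (trans (flip⇒dir e₁₄ flip₂) (sym (flip⇒dir e₁₄ flip₁))))
    where
    -- Adjacent sides are not parallel, since the diagonals are non-degenerate.
    d₂≢d₁ : dir e₂₃ ≢ dir e₁₂
    d₂≢d₁ eq = x₁≢x₃ (backtrack e₁₂ e₂₃ (sym eq))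
    d₂≢d₃ : dir e₂₃ ≢ dir e₄₃
    d₂≢d₃ eq = x₂≢x₄ (backtrack e₂₃ (edge-sym e₄₃) eq)
    flip₁ : lookup x₄ (dir e₁₂) ≡ not (lookup x₁ (dir e₁₂))
    flip₁ = begin
      lookup x₄ (dir e₁₂)       ≡⟨ sym (coord-off e₄₃ (λ eq → d₃≢d₁ (sym eq))) ⟩
      lookup x₃ (dir e₁₂)       ≡⟨ coord-off e₂₃ (λ eq → d₂≢d₁ (sym eq)) ⟩
      lookup x₂ (dir e₁₂)       ≡⟨ coord-on e₁₂ refl ⟩
      not (lookup x₁ (dir e₁₂)) ∎
    flip₂ : lookup x₄ (dir e₂₃) ≡ not (lookup x₁ (dir e₂₃))
    flip₂ = begin
      lookup x₄ (dir e₂₃)       ≡⟨ sym (coord-off e₄₃ d₂≢d₃) ⟩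
      lookup x₃ (dir e₂₃)       ≡⟨ coord-on e₂₃ refl ⟩
      not (lookup x₂ (dir e₂₃)) ≡⟨ cong not (coord-off e₁₂ d₂≢d₁) ⟩
      not (lookup x₁ (dir e₂₃)) ∎

≅-refl : {A : Graph} → A ≅ A
to ≅-refl x = x
from ≅-refl x = x
from∘to ≅-refl _ = refl
to∘from ≅-refl _ = refl
to-adj ≅-refl _ _ e = e
from-adj ≅-refl _ _ e = e

≅-trans : {A B C : Graph} → A ≅ B → B ≅ C → A ≅ C
to (≅-trans σ τ) x = to τ (to σ x)
from (≅-trans σ τ) x = from σ (from τ x)
from∘to (≅-trans σ τ) x = trans (cong (from σ) (from∘to τ (to σ x))) (from∘to σ x)
to∘from (≅-trans σ τ) x = trans (cong (to τ) (to∘from σ (from τ x))) (to∘from τ x)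
to-adj (≅-trans σ τ) x y e = to-adj τ _ _ (to-adj σ x y e)
from-adj (≅-trans σ τ) x y e = from-adj σ x y (from-adj τ _ _ e)

to-injective : {A B : Graph} (σ : A ≅ B) {x y : V A} → to σ x ≡ to σ y → x ≡ y
to-injective σ {x} {y} eq =
  trans (sym (from∘to σ x)) (trans (cong (from σ) eq) (from∘to σ y))

□-cong : {A A' B B' : Graph} → A ≅ A' → B ≅ B' → (A □ B) ≅ (A' □ B')
to (□-cong σ τ) (a , b) = to σ a , to τ b
from (□-cong σ τ) (a , b) = from σ a , from τ b
from∘to (□-cong σ τ) (a , b) = cong₂ _,_ (from∘to σ a) (from∘to τ b)
to∘from (□-cong σ τ) (a , b) = cong₂ _,_ (to∘from σ a) (to∘from τ b)
to-adj (□-cong σ τ) (a , b) (a' , b') (inj₁ (eq , e)) = inj₁ (cong (to σ) eq , to-adj τ b b' e)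
to-adj (□-cong σ τ) (a , b) (a' , b') (inj₂ (eq , e)) = inj₂ (cong (to τ) eq , to-adj σ a a' e)
from-adj (□-cong σ τ) (a , b) (a' , b') (inj₁ (eq , e)) = inj₁ (to-injective σ eq , from-adj τ b b' e)
from-adj (□-cong σ τ) (a , b) (a' , b') (inj₂ (eq , e)) = inj₂ (to-injective τ eq , from-adj σ a a' e)

K₁-□ : {X : Graph} → (K₁ □ X) ≅ X
to K₁-□ (_ , x) = x
from K₁-□ x = tt , x
from∘to K₁-□ (tt , _) = refl
to∘from K₁-□ _ = refl
to-adj K₁-□ (tt , _) (tt , _) (inj₁ (_ , e)) = e
to-adj K₁-□ (tt , _) (tt , _) (inj₂ (_ , ()))
from-adj K₁-□ (tt , _) (tt , _) e = inj₁ (refl , e)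

□-exchange : {A B C : Graph} → (A □ (B □ C)) ≅ (B □ (A □ C))
to □-exchange (a , (b , c)) = b , (a , c)
from □-exchange (b , (a , c)) = a , (b , c)
from∘to □-exchange _ = refl
to∘from □-exchange _ = refl
to-adj □-exchange _ _ (inj₁ (refl , inj₁ (refl , e))) = inj₁ (refl , inj₁ (refl , e))
to-adj □-exchange _ _ (inj₁ (refl , inj₂ (refl , e))) = inj₂ (refl , e)
to-adj □-exchange _ _ (inj₂ (refl , e)) = inj₁ (refl , inj₂ (refl , e))
from-adj □-exchange _ _ (inj₁ (refl , inj₁ (refl , e))) = inj₁ (refl , inj₁ (refl , e))
from-adj □-exchange _ _ (inj₁ (refl , inj₂ (refl , e))) = inj₂ (refl , e)
from-adj □-exchange _ _ (inj₂ (refl , e)) = inj₁ (refl , inj₂ (refl , e))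

induced-transport : {A B : Graph} (σ : A ≅ B) (p : V A → Bool) →
                    induced A p ≅ induced B (λ y → p (from σ y))
to (induced-transport σ p) (x , px) = to σ x , subst T (cong p (sym (from∘to σ x))) px
from (induced-transport σ p) (y , py) = from σ y , py
from∘to (induced-transport σ p) (x , _) = Σ-T-≡ {p = p} (from∘to σ x)
to∘from (induced-transport σ p) (y , _) = Σ-T-≡ {p = λ y → p (from σ y)} (to∘from σ y)
to-adj (induced-transport σ p) (x , _) (y , _) e = to-adj σ x y e
from-adj (induced-transport σ p) (x , _) (y , _) e = from-adj σ x y e

induced-full : {A : Graph} {p : V A → Bool} → (∀ v → p v ≡ true) → induced A p ≅ A
to (induced-full _) (v , _) = v
from (induced-full p-true) v = v , subst T (sym (p-true v)) tt
from∘to (induced-full {p = p} _) _ = Σ-T-≡ {p = p} refl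
to∘from (induced-full _) _ = refl
to-adj (induced-full _) _ _ e = e
from-adj (induced-full _) _ _ e = e

induced-empty : {A : Graph} {p : V A → Bool} → (∀ v → p v ≡ false) → induced A p ≅ Empty
to (induced-empty p-false) (v , pv) = subst T (p-false v) pv
from (induced-empty _) ()
from∘to (induced-empty p-false) (v , pv) = ⊥-elim (subst T (p-false v) pv)
to∘from (induced-empty _) ()
to-adj (induced-empty p-false) (v , pv) _ _ = ⊥-elim (subst T (p-false v) pv)
from-adj (induced-empty p-false) (v , pv) _ _ = ⊥-elim (subst T (p-false v) pv)

induced-single : {G : Graph} {t : V G → Bool} (a : V G) → T (t a) →
                 (∀ b → T (t b) → b ≡ a) → ¬ E G a a → induced G t ≅ K₁
to (induced-single _ _ _ _) _ = tt
from (induced-single a ta _ _) tt = a , ta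
from∘to (induced-single {t = t} _ _ only _) (b , tb) = Σ-T-≡ {p = t} (sym (only b tb))
to∘from (induced-single _ _ _ _) tt = refl
to-adj (induced-single {G} _ _ only noLoop) (b , tb) (c , tc) e =
  noLoop (subst₂ (E G) (only b tb) (only c tc) e)
from-adj (induced-single _ _ _ _) _ _ ()

induced-second : {A X : Graph} {p : V (A □ X) → Bool} {s : V X → Bool} →
                 (∀ a w → p (a , w) ≡ s w) → induced (A □ X) p ≅ (A □ induced X s)
to (induced-second h) ((a , w) , pw) = a , (w , subst T (h a w) pw)
from (induced-second h) (a , (w , sw)) = (a , w) , subst T (sym (h a w)) sw
from∘to (induced-second {p = p} _) _ = Σ-T-≡ {p = p} refl
to∘from (induced-second {s = s} _) (a , _) = cong (a ,_) (Σ-T-≡ {p = s} refl)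
to-adj (induced-second _) _ _ (inj₁ (eq , e)) = inj₁ (eq , e)
to-adj (induced-second {s = s} _) _ _ (inj₂ (refl , e)) = inj₂ (Σ-T-≡ {p = s} refl , e)
from-adj (induced-second _) _ _ (inj₁ (eq , e)) = inj₁ (eq , e)
from-adj (induced-second _) _ _ (inj₂ (eq , e)) = inj₂ (cong proj₁ eq , e)

induced-first : {A X : Graph} {p : V (A □ X) → Bool} {t : V A → Bool} →
                (∀ a w → p (a , w) ≡ t a) → induced (A □ X) p ≅ (induced A t □ X)
to (induced-first h) ((a , w) , pw) = (a , subst T (h a w) pw) , w
from (induced-first h) ((a , ta) , w) = (a , w) , subst T (sym (h a w)) ta
from∘to (induced-first {p = p} _) _ = Σ-T-≡ {p = p} refl
to∘from (induced-first {t = t} _) (_ , w) = cong (_, w) (Σ-T-≡ {p = t} refl)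
to-adj (induced-first {t = t} _) _ _ (inj₁ (refl , e)) = inj₁ (Σ-T-≡ {p = t} refl , e)
to-adj (induced-first _) _ _ (inj₂ (eq , e)) = inj₂ (eq , e)
from-adj (induced-first _) _ _ (inj₁ (eq , e)) = inj₁ (cong proj₁ eq , e)
from-adj (induced-first _) _ _ (inj₂ (eq , e)) = inj₂ (eq , e)

pattern v₀ = zero
pattern v₁ = suc zero
pattern v₂ = suc (suc zero)

firstVsRest : Bool → Bool → Fin 3 → Bool
firstVsRest u v v₀ = u
firstVsRest u v v₁ = v
firstVsRest u v v₂ = v

initVsLast : Bool → Bool → Fin 3 → Bool
initVsLast u v v₀ = u
initVsLast u v v₁ = u
initVsLast u v v₂ = v

data RowShape (t : Fin 3 → Bool) : Set where
  noRow   : (∀ a → t a ≡ false) → RowShape t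
  allRows : (∀ a → t a ≡ true) → RowShape t
  oneRow  : induced (P 3) t ≅ K₁ → RowShape t
  twoRows : induced (P 3) t ≅ P 2 → RowShape t

rest≅P₂ : induced (P 3) (firstVsRest false true) ≅ P 2
to rest≅P₂ (v₁ , _) = zero
to rest≅P₂ (v₂ , _) = suc zero
from rest≅P₂ zero = v₁ , tt
from rest≅P₂ (suc zero) = v₂ , tt
from∘to rest≅P₂ (v₁ , tt) = refl
from∘to rest≅P₂ (v₂ , tt) = refl
to∘from rest≅P₂ zero = refl
to∘from rest≅P₂ (suc zero) = refl
to-adj rest≅P₂ (v₁ , _) (v₁ , _) (inj₁ ())
to-adj rest≅P₂ (v₁ , _) (v₁ , _) (inj₂ ())
to-adj rest≅P₂ (v₁ , _) (v₂ , _) _ = inj₁ refl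
to-adj rest≅P₂ (v₂ , _) (v₁ , _) _ = inj₂ refl
to-adj rest≅P₂ (v₂ , _) (v₂ , _) (inj₁ ())
to-adj rest≅P₂ (v₂ , _) (v₂ , _) (inj₂ ())
from-adj rest≅P₂ (v₁ , _) (v₁ , _) (inj₁ ())
from-adj rest≅P₂ (v₁ , _) (v₁ , _) (inj₂ ())
from-adj rest≅P₂ (v₁ , _) (v₂ , _) _ = inj₁ refl
from-adj rest≅P₂ (v₂ , _) (v₁ , _) _ = inj₂ refl
from-adj rest≅P₂ (v₂ , _) (v₂ , _) (inj₁ ())
from-adj rest≅P₂ (v₂ , _) (v₂ , _) (inj₂ ())

init≅P₂ : induced (P 3) (initVsLast true false) ≅ P 2
to init≅P₂ (v₀ , _) = zero
to init≅P₂ (v₁ , _) = suc zero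
to init≅P₂ (v₂ , ())
from init≅P₂ zero = v₀ , tt
from init≅P₂ (suc zero) = v₁ , tt
from∘to init≅P₂ (v₀ , tt) = refl
from∘to init≅P₂ (v₁ , tt) = refl
from∘to init≅P₂ (v₂ , ())
to∘from init≅P₂ zero = refl
to∘from init≅P₂ (suc zero) = refl
to-adj init≅P₂ (v₂ , ()) _ _
to-adj init≅P₂ _ (v₂ , ()) _
to-adj init≅P₂ (v₀ , _) (v₀ , _) (inj₁ ())
to-adj init≅P₂ (v₀ , _) (v₀ , _) (inj₂ ())
to-adj init≅P₂ (v₀ , _) (v₁ , _) _ = inj₁ refl
to-adj init≅P₂ (v₁ , _) (v₀ , _) _ = inj₂ refl
to-adj init≅P₂ (v₁ , _) (v₁ , _) (inj₁ ())
to-adj init≅P₂ (v₁ , _) (v₁ , _) (inj₂ ())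
from-adj init≅P₂ (v₂ , ()) _ _
from-adj init≅P₂ _ (v₂ , ()) _
from-adj init≅P₂ (v₀ , _) (v₀ , _) (inj₁ ())
from-adj init≅P₂ (v₀ , _) (v₀ , _) (inj₂ ())
from-adj init≅P₂ (v₀ , _) (v₁ , _) _ = inj₁ refl
from-adj init≅P₂ (v₁ , _) (v₀ , _) _ = inj₂ refl
from-adj init≅P₂ (v₁ , _) (v₁ , _) (inj₁ ())
from-adj init≅P₂ (v₁ , _) (v₁ , _) (inj₂ ())

P₃-loopless : {a : Fin 3} → ¬ E (P 3) a a
P₃-loopless {v₀} (inj₁ ())
P₃-loopless {v₀} (inj₂ ())
P₃-loopless {v₁} (inj₁ ())
P₃-loopless {v₁} (inj₂ ())
P₃-loopless {v₂} (inj₁ ())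
P₃-loopless {v₂} (inj₂ ())

firstVsRest-shape : (u v : Bool) → RowShape (firstVsRest u v)
firstVsRest-shape false false = noRow λ { v₀ → refl ; v₁ → refl ; v₂ → refl }
firstVsRest-shape true true = allRows λ { v₀ → refl ; v₁ → refl ; v₂ → refl }
firstVsRest-shape true false =
  oneRow (induced-single v₀ tt (λ { v₀ _ → refl ; v₁ () ; v₂ () }) P₃-loopless)
firstVsRest-shape false true = twoRows rest≅P₂

initVsLast-shape : (u v : Bool) → RowShape (initVsLast u v)
initVsLast-shape false false = noRow λ { v₀ → refl ; v₁ → refl ; v₂ → refl }
initVsLast-shape true true = allRows λ { v₀ → refl ; v₁ → refl ; v₂ → refl }
initVsLast-shape false true =
  oneRow (induced-single v₂ tt (λ { v₀ () ; v₁ () ; v₂ _ → refl }) P₃-loopless)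
initVsLast-shape true false = twoRows init≅P₂

Grid : ℕ → Graph
Grid m = P 3 ^ m

corner : (m : ℕ) → V (Grid m)
corner zero = tt
corner (suc m) = v₀ , corner m

grid-connected : {A : Set} (m : ℕ) (h : V (Grid m) → A) →
                 (∀ u v → E (Grid m) u v → h u ≡ h v) → ∀ v → h v ≡ h (corner m)
grid-connected zero h _ tt = refl
grid-connected (suc m) h invariant (a , w) =
  trans (along-path a) (grid-connected m (λ w → h (v₀ , w)) invariant-in-row₀ w)
  where
  invariant-in-row₀ : ∀ u v → E (Grid m) u v → h (v₀ , u) ≡ h (v₀ , v)
  invariant-in-row₀ u v e = invariant _ _ (inj₁ (refl , e))
  along-path : ∀ a → h (a , w) ≡ h (v₀ , w)
  along-path v₀ = refl
  along-path v₁ = sym (invariant (v₀ , w) (v₁ , w) (inj₂ (refl , inj₁ refl)))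
  along-path v₂ =
    trans (sym (invariant (v₁ , w) (v₂ , w) (inj₂ (refl , inj₁ refl)))) (along-path v₁)

data Shape : (m : ℕ) → (V (Grid m) → Bool) → Set where
  none      : ∀ {m p} → (∀ v → p v ≡ false) → Shape m p
  whole     : ∀ {m p} → (∀ v → p v ≡ true) → Shape m p
  oneLayer  : ∀ {m p} → induced (Grid (suc m)) p ≅ Grid m → Shape (suc m) p
  twoLayers : ∀ {m p} → induced (Grid (suc m)) p ≅ (P 2 □ Grid m) → Shape (suc m) p

shape₀ : (p : V (Grid 0) → Bool) → Shape 0 p
shape₀ p with p tt in eq
... | false = none λ { tt → eq }
... | true = whole λ { tt → eq }

lift-columns : {m : ℕ} {p : V (Grid (suc m)) → Bool} {s : V (Grid m) → Bool} →
               (∀ a w → p (a , w) ≡ s w) → Shape m s → Shape (suc m) p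
lift-columns h (none s-false) = none λ (a , w) → trans (h a w) (s-false w)
lift-columns h (whole s-true) = whole λ (a , w) → trans (h a w) (s-true w)
lift-columns h (oneLayer σ) = oneLayer (≅-trans (induced-second h) (□-cong ≅-refl σ))
lift-columns h (twoLayers σ) =
  twoLayers (≅-trans (induced-second h) (≅-trans (□-cong ≅-refl σ) □-exchange))

lift-rows : {m : ℕ} {p : V (Grid (suc m)) → Bool} {t : Fin 3 → Bool} →
            (∀ a w → p (a , w) ≡ t a) → RowShape t → Shape (suc m) p
lift-rows h (noRow t-false) = none λ (a , w) → trans (h a w) (t-false a)
lift-rows h (allRows t-true) = whole λ (a , w) → trans (h a w) (t-true a)
lift-rows h (oneRow σ) =
  oneLayer (≅-trans (induced-first h) (≅-trans (□-cong σ ≅-refl) K₁-□))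
lift-rows h (twoRows σ) = twoLayers (≅-trans (induced-first h) (□-cong σ ≅-refl))

shape-iso : {m : ℕ} {p : V (Grid (suc m)) → Bool} {H : Graph} →
            H ≅ induced (Grid (suc m)) p → Shape (suc m) p →
            (H ≅ Empty) ⊎ (H ≅ Grid m) ⊎ (H ≅ (P 2 □ Grid m)) ⊎ (H ≅ Grid (suc m))
shape-iso τ (none p-false) = inj₁ (≅-trans τ (induced-empty p-false))
shape-iso τ (oneLayer σ) = inj₂ (inj₁ (≅-trans τ σ))
shape-iso τ (twoLayers σ) = inj₂ (inj₂ (inj₁ (≅-trans τ σ)))
shape-iso τ (whole p-true) = inj₂ (inj₂ (inj₂ (≅-trans τ (induced-full p-true))))

record Embedding (G : Graph) (n : ℕ) : Set where
  field
    map       : V G → Vec Bool n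
    injective : ∀ {u v} → map u ≡ map v → u ≡ v
    adjacent  : ∀ {u v} → E G u v → Edge (map u) (map v)
open Embedding

subgraph-embedding : {G : Graph} {n : ℕ} (H : Subgraph (Q n)) →
                     asGraph H ≅ G → Embedding G n
map (subgraph-embedding H σ) u = proj₁ (from σ u)
injective (subgraph-embedding H σ) {u} {v} eq = begin
  u                ≡⟨ sym (to∘from σ u) ⟩
  to σ (from σ u)  ≡⟨ cong (to σ) (Σ-T-≡ {p = vs H} eq) ⟩
  to σ (from σ v)  ≡⟨ to∘from σ v ⟩
  v                ∎
adjacent (subgraph-embedding {G} H σ) {u} {v} uv =
  Q-edge (es-E H _ _ (from-adj σ _ _ (subst₂ (E G) (sym (to∘from σ u)) (sym (to∘from σ v)) uv)))

module _ {A X : Graph} {n : ℕ} (φ : Embedding (A □ X) n) where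

  restrict : V A → Embedding X n
  map (restrict a) w = map φ (a , w)
  injective (restrict a) eq = cong proj₂ (injective φ eq)
  adjacent (restrict a) e = adjacent φ (inj₁ (refl , e))

  rung : {a b : V A} → E A a b → (w : V X) → Edge (map φ (a , w)) (map φ (b , w))
  rung ab w = adjacent φ (inj₂ (refl , ab))

  copies-apart : {a b : V A} → a ≢ b → ∀ {u v} → map φ (a , u) ≢ map φ (b , v)
  copies-apart a≢b eq = a≢b (cong proj₁ (injective φ eq))

module _ {A : Graph} {m n : ℕ} (φ : Embedding (A □ Grid m) n)
         {a b : V A} (ab : E A a b) (a≢b : a ≢ b) where

  rungs-parallel : ∀ w → dir (rung φ ab w) ≡ dir (rung φ ab (corner m))
  rungs-parallel = grid-connected m (λ w → dir (rung φ ab w)) square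
    where
    square : ∀ u v → E (Grid m) u v → dir (rung φ ab u) ≡ dir (rung φ ab v)
    square u v uv =
      parallel-sides (rung φ ab u) (adjacent (restrict φ b) uv) (rung φ ab v)
                     (adjacent (restrict φ a) uv)
                     (copies-apart φ a≢b) (copies-apart φ (λ eq → a≢b (sym eq)))

  -- If all rungs over ab point in direction d, coordinate d is constant on the
  -- copy {a} × (P₃)ᵐ: an edge of that copy in direction d would backtrack along a rung.
  copy-constant : {d : Fin n} → (∀ w → dir (rung φ ab w) ≡ d) →
                  ∀ w → lookup (map φ (a , w)) d ≡ lookup (map φ (a , corner m)) d
  copy-constant {d} rungs-d = grid-connected m (λ w → lookup (map φ (a , w)) d) invariant
    where
    invariant : ∀ u v → E (Grid m) u v → lookup (map φ (a , u)) d ≡ lookup (map φ (a , v)) d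
    invariant u v uv = sym (coord-off e d≢dir)
      where
      e : Edge (map φ (a , u)) (map φ (a , v))
      e = adjacent (restrict φ a) uv
      d≢dir : d ≢ dir e
      d≢dir d≡dir = copies-apart φ a≢b
        (backtrack (edge-sym e) (rung φ ab u) (trans (sym d≡dir) (sym (rungs-d u))))

layered : {m n : ℕ} (φ : Embedding (Grid (suc m)) n) (i : Fin n) (r : Bool → Bool) →
          Shape m (λ w → r (lookup (map φ (v₀ , w)) i)) →
          Shape (suc m) (λ v → r (lookup (map φ v) i))
layered {m} {n} φ i r row₀-shape = by-cases (i ≟ᶠ d₀) (i ≟ᶠ d₁)
  where
  coord : Fin 3 → V (Grid m) → Bool
  coord a w = lookup (map φ (a , w)) i
  z : V (Grid m)
  z = corner m
  rung₀₁ : ∀ w → Edge (map φ (v₀ , w)) (map φ (v₁ , w))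
  rung₀₁ = rung φ (inj₁ refl)
  rung₁₂ : ∀ w → Edge (map φ (v₁ , w)) (map φ (v₂ , w))
  rung₁₂ = rung φ (inj₁ refl)
  d₀ d₁ : Fin n
  d₀ = dir (rung₀₁ z)
  d₁ = dir (rung₁₂ z)
  parallel₀₁ : ∀ w → dir (rung₀₁ w) ≡ d₀
  parallel₀₁ = rungs-parallel {m = m} φ (inj₁ refl) (λ ())
  parallel₁₂ : ∀ w → dir (rung₁₂ w) ≡ d₁
  parallel₁₂ = rungs-parallel {m = m} φ (inj₁ refl) (λ ())

  -- The two families of rungs are not parallel, else row 0 meets row 2.
  d₀≢d₁ : d₀ ≢ d₁
  d₀≢d₁ eq = copies-apart φ (λ ()) (backtrack (rung₀₁ z) (rung₁₂ z) eq)

  keep₀₁ : i ≢ d₀ → ∀ w → coord v₁ w ≡ coord v₀ w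
  keep₀₁ i≢d₀ w = coord-off (rung₀₁ w) (λ eq → i≢d₀ (trans eq (parallel₀₁ w)))
  keep₁₂ : i ≢ d₁ → ∀ w → coord v₂ w ≡ coord v₁ w
  keep₁₂ i≢d₁ w = coord-off (rung₁₂ w) (λ eq → i≢d₁ (trans eq (parallel₁₂ w)))
  flip₀₁ : i ≡ d₀ → ∀ w → coord v₁ w ≡ not (coord v₀ w)
  flip₀₁ i≡d₀ w = coord-on (rung₀₁ w) (trans i≡d₀ (sym (parallel₀₁ w)))
  flip₁₂ : i ≡ d₁ → ∀ w → coord v₂ w ≡ not (coord v₁ w)
  flip₁₂ i≡d₁ w = coord-on (rung₁₂ w) (trans i≡d₁ (sym (parallel₁₂ w)))

  by-cases : Dec (i ≡ d₀) → Dec (i ≡ d₁) → Shape (suc m) (λ v → r (lookup (map φ v) i))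
  by-cases (yes i≡d₀) (yes i≡d₁) = ⊥-elim (d₀≢d₁ (trans (sym i≡d₀) i≡d₁))
  by-cases (no i≢d₀) (no i≢d₁) = lift-columns (λ a w → cong r (as-row₀ a w)) row₀-shape
    where
    as-row₀ : ∀ a w → coord a w ≡ coord v₀ w
    as-row₀ v₀ w = refl
    as-row₀ v₁ w = keep₀₁ i≢d₀ w
    as-row₀ v₂ w = trans (keep₁₂ i≢d₁ w) (keep₀₁ i≢d₀ w)
  by-cases (yes i≡d₀) (no i≢d₁) = lift-rows cut (firstVsRest-shape (r c) (r (not c)))
    where
    c : Bool
    c = coord v₀ z
    row₀ : ∀ w → coord v₀ w ≡ c
    row₀ = copy-constant {m = m} φ (inj₁ refl) (λ ())
                         (λ w → trans (parallel₀₁ w) (sym i≡d₀))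
    cut : ∀ a w → r (coord a w) ≡ firstVsRest (r c) (r (not c)) a
    cut v₀ w = cong r (row₀ w)
    cut v₁ w = cong r (trans (flip₀₁ i≡d₀ w) (cong not (row₀ w)))
    cut v₂ w = cong r (trans (keep₁₂ i≢d₁ w)
                          (trans (flip₀₁ i≡d₀ w) (cong not (row₀ w))))
  by-cases (no i≢d₀) (yes i≡d₁) = lift-rows cut (initVsLast-shape (r c) (r (not c)))
    where
    c : Bool
    c = coord v₁ z
    row₁ : ∀ w → coord v₁ w ≡ c
    row₁ = copy-constant {m = m} φ (inj₁ refl) (λ ())
                         (λ w → trans (parallel₁₂ w) (sym i≡d₁))
    cut : ∀ a w → r (coord a w) ≡ initVsLast (r c) (r (not c)) a
    cut v₀ w = cong r (trans (sym (keep₀₁ i≢d₀ w)) (row₁ w))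
    cut v₁ w = cong r (row₁ w)
    cut v₂ w = cong r (trans (flip₁₂ i≡d₁ w) (cong not (row₁ w)))

classify : (m : ℕ) {n : ℕ} (φ : Embedding (Grid m) n) (i : Fin n) (r : Bool → Bool) →
           Shape m (λ v → r (lookup (map φ v) i))
classify zero φ i r = shape₀ _
classify (suc m) φ i r = layered φ i r (classify m (restrict φ v₀) i r)

proposition13 : (k n : ℕ) → 1 ≤ k → 1 ≤ n →
    (H : Subgraph (Q n)) → asGraph H ≅ (P 3 ^ k) →
    (i : Fin n) (ε : Bool) →
    let HS = induced (asGraph H) (λ v → inSubcube i ε (proj₁ v)) in
    (HS ≅ Empty) ⊎ (HS ≅ (P 3 ^ (k ∸ 1))) ⊎
    (HS ≅ (P 2 □ (P 3 ^ (k ∸ 1)))) ⊎ (HS ≅ (P 3 ^ k))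
proposition13 zero n () _ H σ i ε
proposition13 (suc m) n _ _ H σ i ε =
  shape-iso (induced-transport σ _)
            (classify (suc m) (subgraph-embedding H σ) i (λ b → does (b ≟ᵇ ε)))
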